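{- Let $w$ be a word with $s_1(w)=s_2(w)=2$ (a 2FS square), and let $sq_1,SQ_1$ (resp. $sq_2,SQ_2$) be the roots of the two squares whose last occurrence in $w$ starts at location 1 (resp. 2), with $|sq_1|<|SQ_1|$ and $|sq_2|<|SQ_2|$. If $|sq_1|=|sq_2|$, then $|SQ_1|=|SQ_2|$.
   Context: A square is a word $uu$ with $u$ nonempty; $u$ is its root. A square $uu$ occurs at location $k$ of $w=a_1\cdots a_n$ if $a_k\cdots a_{k+2|u|-1}=uu$. $s_k(w)$ is the number of distinct squares occurring at location $k$ of $w$ but at no location $k'>k$. It is known that $s_k(w)\le 2$. -}

module Defs where

open import Data.Nat using (ℕ; suc; _<_; _∸_)
open import Data.List using (List; []; _++_; drop)
open import Data.Product using (_×_; ∃-syntax)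
open import Data.Sum using (_⊎_)
open import Relation.Nullary using (¬_)
open import Relation.Binary.PropositionalEquality using (_≡_; _≢_)

-- Words over an alphabet A are lists; locations are 1-based.
data OccursAt {A : Set} (w : List A) : ℕ → List A → Set where
  occ : ∀ k u (s : List A) → drop k w ≡ u ++ u ++ s → OccursAt w (suc k) u

LastOccAt : {A : Set} → List A → ℕ → List A → Set
LastOccAt w k u = (u ≢ []) × OccursAt w k u × (∀ k' → k < k' → ¬ OccursAt w k' u)

-- s_k(w) = 2 with the two counted squares having roots u and v:
-- u ≠ v, both have their last occurrence at location k, and every square
-- whose last occurrence is at location k has root u or v.
-- (Distinct squares ⇔ distinct roots.)
TwoLastAt : {A : Set} → List A → ℕ → List A → List A → Set
TwoLastAt w k u v =
  (u ≢ v) × LastOccAt w k u × LastOccAt w k v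
  × (∀ x → LastOccAt w k x → (x ≡ u) ⊎ (x ≡ v))

{-# OPTIONS --safe #-}
-- Write p = |sq₁| = |sq₂|, P = |SQ₁| = p + d and Q = |SQ₂| = p + e, positions 0-based.
-- Then w[0, 2p] has period p, w[0, 2P) period P and w[1, 2Q] period Q, and P, Q < 2p,
-- since otherwise sq₁ sq₁ (resp. sq₂ sq₂) would occur again P (resp. Q) places later.
-- Composing periods p and P gives period d on w[p, 2p + d]; likewise e on w[p + 1, 2p + e].
-- If d ≠ e, Fine–Wilf turns d and e into g = gcd d e, which spreads over the longer of the
-- two ranges, and then g and the smaller of P, Q into a period r ∣ p on w[p + 1, 2p + r].
-- With period p on w[1, 2p] this makes w[1, 2p + r] r-periodic, so sq₂ sq₂ occurs again at
-- 1 + r, contradicting that its last occurrence starts at location 2.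
module Submission where

open import Defs
open import Data.Nat using (ℕ; zero; suc; _+_; _*_; _∸_; _≤_; _<_; z≤n; s≤s; z<s; _≟_; _<?_; _≤?_; >-nonZero)
open import Data.Nat.Properties
open import Data.Nat.Divisibility
  using (_∣_; divides; ∣-refl; ∣-trans; ∣-antisym; ∣⇒≤; ∣m+n∣m⇒∣n; ∣m∣n⇒∣m+n)
open import Data.Nat.GCD
  using (gcd; gcd[m,n]∣m; gcd[m,n]∣n; gcd-greatest; gcd[m,n]≢0; gcd[m,n]≤n; gcd-comm; gcd-identityˡ; gcd-identityʳ)
open import Data.Nat.Induction using (<-rec; <-wellFounded)
open import Data.Nat.Tactic.RingSolver using (solve)
open import Data.List using (List; []; _∷_; _++_; drop; length)
open import Data.List.Properties using (length-++; ++-assoc)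
open import Data.Maybe using (Maybe; just; nothing)
open import Data.Maybe.Properties using (just-injective)
open import Data.Product using (_×_; _,_; proj₁; proj₂; ∃-syntax)
open import Data.Sum using (inj₁; inj₂)
open import Data.Empty using (⊥-elim)
open import Induction.WellFounded using (Acc; acc)
open import Relation.Nullary using (¬_; yes; no)
open import Relation.Binary using (tri<; tri≈; tri>)
open import Relation.Binary.PropositionalEquality

m+n≤o⇒∃[j]m≤j×o≡j+n : ∀ {m n o} → m + n ≤ o → ∃[ j ] m ≤ j × o ≡ j + n
m+n≤o⇒∃[j]m≤j×o≡j+n {m} {n} {o} m+n≤o =
  o ∸ n , m+n≤o⇒m≤o∸n m m+n≤o , sym (m∸n+n≡m (m+n≤o⇒n≤o m m+n≤o))

m+n+o≡m+o+n : ∀ m n o → m + n + o ≡ m + o + n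
m+n+o≡m+o+n m n o = solve (m ∷ n ∷ o ∷ [])

m+n+o≡m+[o+n] : ∀ m n o → m + n + o ≡ m + (o + n)
m+n+o≡m+[o+n] m n o = solve (m ∷ n ∷ o ∷ [])

m+n+[m+o]≡m+m+[o+n] : ∀ m n o → m + n + (m + o) ≡ m + m + (o + n)
m+n+[m+o]≡m+m+[o+n] m n o = solve (m ∷ n ∷ o ∷ [])

m<n<m+m⇒∃[d]n≡m+d : ∀ {m n} → m < n → n < m + m → ∃[ d ] n ≡ m + d × 0 < d × d ≤ m
m<n<m+m⇒∃[d]n≡m+d {m} m<n n<m+m with m≤n⇒∃[o]m+o≡n m<n
... | k , refl = suc k , sym (+-suc m k) , z<s ,
  +-cancelˡ-≤ m (suc k) m (subst (_≤ m + m) (sym (+-suc m k)) (<⇒≤ n<m+m))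

m<n∧d∣m∧d∣n⇒m+d≤n : ∀ {m n d} → m < n → d ∣ m → d ∣ n → m + d ≤ n
m<n∧d∣m∧d∣n⇒m+d≤n {m} {d = d} m<n d∣m d∣n with m≤n⇒∃[o]m+o≡n m<n
... | k , refl = subst (m + d ≤_) (+-suc m k) (+-monoʳ-≤ m (∣⇒≤ d∣suc[k]))
  where
  d∣suc[k] : d ∣ suc k
  d∣suc[k] = ∣m+n∣m⇒∣n (subst (d ∣_) (sym (+-suc m k)) d∣n) d∣m

gcd[m,n]≤m : ∀ {m} n → 0 < m → gcd m n ≤ m
gcd[m,n]≤m {m} n 0<m = ∣⇒≤ {{>-nonZero 0<m}} (gcd[m,n]∣m m n)

m>0⇒gcd[m,n]>0 : ∀ {m} n → 0 < m → 0 < gcd m n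
m>0⇒gcd[m,n]>0 {m} n 0<m = n≢0⇒n>0 (gcd[m,n]≢0 m n (inj₁ (>⇒≢ 0<m)))

m+k≡n⇒gcd[m,n]≡gcd[m,k] : ∀ m {k n} → m + k ≡ n → gcd m n ≡ gcd m k
m+k≡n⇒gcd[m,n]≡gcd[m,k] m {k} refl = ∣-antisym
  (gcd-greatest (gcd[m,n]∣m m (m + k)) (∣m+n∣m⇒∣n (gcd[m,n]∣n m (m + k)) (gcd[m,n]∣m m (m + k))))
  (gcd-greatest (gcd[m,n]∣m m k) (∣m∣n⇒∣m+n (gcd[m,n]∣m m k) (gcd[m,n]∣n m k)))

gcd[m,n+o]∣n : ∀ {m} n {o} → m ∣ o → gcd m (n + o) ∣ n
gcd[m,n+o]∣n {m} n {o} m∣o = ∣m+n∣m⇒∣n (subst (gcd m (n + o) ∣_) (+-comm n o) (gcd[m,n]∣n m (n + o)))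
                                       (∣-trans (gcd[m,n]∣m m (n + o)) m∣o)

module Periodicity {B : Set} (f : ℕ → B) where

  Periodic : ℕ → ℕ → ℕ → Set
  Periodic r a b = ∀ i → a ≤ i → i + r < b → f i ≡ f (i + r)

  module _ {r a b : ℕ} where

    Periodic-mono : ∀ {a' b'} → a ≤ a' → b' ≤ b → Periodic r a b → Periodic r a' b'
    Periodic-mono a≤a' b'≤b per i a'≤i i+r<b' = per i (≤-trans a≤a' a'≤i) (<-≤-trans i+r<b' b'≤b)

    Periodic-stepˡ : f a ≡ f (a + r) → Periodic r (suc a) b → Periodic r a b
    Periodic-stepˡ fa≡fa+r per i a≤i i+r<b with m≤n⇒m<n∨m≡n a≤i
    ... | inj₁ a<i  = per i a<i i+r<b
    ... | inj₂ refl = fa≡fa+r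

    Periodic-∪ : ∀ {a' c} → a' + r ≤ c → Periodic r a c → Periodic r a' b → Periodic r a b
    Periodic-∪ {a'} a'+r≤c perᶜ perᵇ i a≤i i+r<b with a' ≤? i
    ... | yes a'≤i = perᵇ i a'≤i i+r<b
    ... | no  a'≰i = perᶜ i a≤i (<-≤-trans (+-monoˡ-< r (≰⇒> a'≰i)) a'+r≤c)

    Periodic-* : ∀ k → Periodic r a b → Periodic (k * r) a b
    Periodic-* zero    _   i _   _     = cong f (sym (+-identityʳ i))
    Periodic-* (suc k) per i a≤i i+r+kr<b = begin
      f i               ≡⟨ per i a≤i (≤-<-trans (+-monoʳ-≤ i (m≤m+n r (k * r))) i+r+kr<b) ⟩
      f (i + r)         ≡⟨ Periodic-* k per (i + r) (≤-trans a≤i (m≤m+n i r))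
                             (subst (_< b) (sym (+-assoc i r (k * r))) i+r+kr<b) ⟩
      f (i + r + k * r) ≡⟨ cong f (+-assoc i r (k * r)) ⟩
      f (i + (r + k * r)) ∎
      where open ≡-Reasoning

    Periodic-∣ : ∀ {n} → r ∣ n → Periodic r a b → Periodic n a b
    Periodic-∣ (divides k refl) = Periodic-* k

  Periodic-shift : ∀ {p d a b} → Periodic p a b → Periodic (p + d) a (b + d) → Periodic d (a + p) (b + d)
  Periodic-shift {p} {d} {a} {b} perᵖ perᵖ⁺ᵈ i a+p≤i i+d<b+d with m+n≤o⇒∃[j]m≤j×o≡j+n {a} {p} a+p≤i
  ... | j , a≤j , refl = begin
    f (j + p)       ≡⟨ sym (perᵖ j a≤j (+-cancelʳ-< d (j + p) b i+d<b+d)) ⟩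
    f j             ≡⟨ perᵖ⁺ᵈ j a≤j (subst (_< b + d) (+-assoc j p d) i+d<b+d) ⟩
    f (j + (p + d)) ≡⟨ cong f (sym (+-assoc j p d)) ⟩
    f (j + p + d)   ∎
    where open ≡-Reasoning

  Periodic-difference : ∀ {p k q a b} → p + k ≡ q → a + p + q ≤ b
    → Periodic p a b → Periodic q a b → Periodic k a b
  Periodic-difference {p} {k} {a = a} {b} refl a+p+q≤b perᵖ perᵠ i a≤i i+k<b with i + k + p <? b
  ... | yes i+k+p<b = begin
    f i             ≡⟨ perᵠ i a≤i (subst (_< b) (m+n+o≡m+[o+n] i k p) i+k+p<b) ⟩
    f (i + (p + k)) ≡⟨ cong f (sym (m+n+o≡m+[o+n] i k p)) ⟩
    f (i + k + p)   ≡⟨ sym (perᵖ (i + k) (≤-trans a≤i (m≤m+n i k)) i+k+p<b) ⟩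
    f (i + k)       ∎
    where open ≡-Reasoning
  ... | no i+k+p≮b with m+n≤o⇒∃[j]m≤j×o≡j+n {a} {p} a+p≤i
    where
    a+p≤i : a + p ≤ i
    a+p≤i = +-cancelʳ-≤ (p + k) (a + p) i (≤-trans a+p+q≤b
              (subst (b ≤_) (m+n+o≡m+[o+n] i k p) (≮⇒≥ i+k+p≮b)))
  ... | j , a≤j , refl = begin
    f (j + p)       ≡⟨ sym (perᵖ j a≤j (≤-<-trans (m≤m+n (j + p) k) i+k<b)) ⟩
    f j             ≡⟨ perᵠ j a≤j (subst (_< b) (+-assoc j p k) i+k<b) ⟩
    f (j + (p + k)) ≡⟨ cong f (sym (+-assoc j p k)) ⟩
    f (j + p + k)   ∎
    where open ≡-Reasoning

  fineWilf : ∀ {a b} p q → a + p + q ≤ b → Periodic p a b → Periodic q a b → Periodic (gcd p q) a b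
  fineWilf {a} {b} p q = go p q (<-wellFounded (p + q))
    where
    go : ∀ p q → Acc _<_ (p + q) → a + p + q ≤ b → Periodic p a b → Periodic q a b → Periodic (gcd p q) a b
    go zero    q       _         _    _    perᵠ = subst (λ r → Periodic r a b) (sym (gcd-identityˡ q)) perᵠ
    go (suc p) zero    _         _    perᵖ _    = subst (λ r → Periodic r a b) (sym (gcd-identityʳ (suc p))) perᵖ
    go (suc p) (suc q) (acc rec) room perᵖ perᵠ with ≤-total p q
    ... | inj₁ p≤q with m≤n⇒∃[o]m+o≡n (s≤s p≤q)
    ... | k , p+k≡q = subst (λ r → Periodic r a b) (sym (m+k≡n⇒gcd[m,n]≡gcd[m,k] (suc p) p+k≡q))
      (go (suc p) k (rec (subst (_< suc p + suc q) (sym p+k≡q) (m<n+m (suc q) z<s)))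
          (≤-trans (+-monoʳ-≤ (a + suc p) k≤q) room) perᵖ (Periodic-difference p+k≡q room perᵖ perᵠ))
      where
      k≤q : k ≤ suc q
      k≤q = subst (k ≤_) p+k≡q (m≤n+m k (suc p))
    go (suc p) (suc q) (acc rec) room perᵖ perᵠ | inj₂ q≤p with m≤n⇒∃[o]m+o≡n (s≤s q≤p)
    ... | k , q+k≡p = subst (λ r → Periodic r a b) gcd≡
      (go k (suc q) (rec (+-monoˡ-< (suc q) k<p)) (≤-trans (+-monoˡ-≤ (suc q) (+-monoʳ-≤ a (<⇒≤ k<p))) room)
          (Periodic-difference q+k≡p room′ perᵠ perᵖ) perᵠ)
      where
      k<p : k < suc p
      k<p = subst (k <_) q+k≡p (m<n+m k z<s)
      room′ : a + suc q + suc p ≤ b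
      room′ = subst (_≤ b) (m+n+o≡m+o+n a (suc p) (suc q)) room
      gcd≡ : gcd k (suc q) ≡ gcd (suc p) (suc q)
      gcd≡ = begin
        gcd k (suc q)       ≡⟨ gcd-comm k (suc q) ⟩
        gcd (suc q) k       ≡⟨ m+k≡n⇒gcd[m,n]≡gcd[m,k] (suc q) q+k≡p ⟨
        gcd (suc q) (suc p) ≡⟨ gcd-comm (suc q) (suc p) ⟩
        gcd (suc p) (suc q) ∎
        where open ≡-Reasoning

  Periodic-extend : ∀ {q p a b c} → 0 < q → a + q + p ≤ b → Periodic q a c → Periodic p a b → Periodic p a c
  Periodic-extend {q} {p} {a} {b} {c} 0<q a+q+p≤b perᵠ perᵖ = <-rec _ step
    where
    step : ∀ i → (∀ {j} → j < i → a ≤ j → j + p < c → f j ≡ f (j + p)) → a ≤ i → i + p < c → f i ≡ f (i + p)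
    step i rec a≤i i+p<c with i + p <? b
    ... | yes i+p<b = perᵖ i a≤i i+p<b
    ... | no  i+p≮b with m+n≤o⇒∃[j]m≤j×o≡j+n {a} {q}
                          (+-cancelʳ-≤ p (a + q) i (≤-trans a+q+p≤b (≮⇒≥ i+p≮b)))
    ... | j , a≤j , refl = begin
      f (j + q)     ≡⟨ sym (perᵠ j a≤j (≤-<-trans (m≤m+n (j + q) p) i+p<c)) ⟩
      f j           ≡⟨ rec (m<m+n j 0<q) a≤j (≤-<-trans (+-monoˡ-≤ p (m≤m+n j q)) i+p<c) ⟩
      f (j + p)     ≡⟨ perᵠ (j + p) (≤-trans a≤j (m≤m+n j p)) (subst (_< c) (m+n+o≡m+o+n j q p) i+p<c) ⟩
      f (j + p + q) ≡⟨ cong f (m+n+o≡m+o+n j p q) ⟩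
      f (j + q + p) ∎
      where open ≡-Reasoning

  Periodic-stepˡ-∣ : ∀ {g d a b} → 0 < g → g ∣ d → g ≤ d → a + d < b → f a ≡ f (a + d)
    → Periodic g (suc a) b → Periodic g a b
  Periodic-stepˡ-∣ {g} {d} {a} {b} 0<g g∣d g≤d a+d<b fa≡fa+d perᵍ with m≤n⇒∃[o]m+o≡n g≤d
  ... | x , refl = Periodic-stepˡ (begin
    f a             ≡⟨ fa≡fa+d ⟩
    f (a + (g + x)) ≡⟨ cong f (sym (+-assoc a g x)) ⟩
    f (a + g + x)   ≡⟨ Periodic-∣ g∣x perᵍ (a + g) (m<m+n a 0<g) (subst (_< b) (sym (+-assoc a g x)) a+d<b) ⟨
    f (a + g)       ∎) perᵍ
    where
    open ≡-Reasoning
    g∣x : g ∣ x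
    g∣x = ∣m+n∣m⇒∣n g∣d ∣-refl

  Periodic-extendˡ : ∀ {r p a b c} → r ∣ p → a + p + p ≤ c → c + r ≤ b
    → Periodic p a c → Periodic r (a + p) b → Periodic r a b
  Periodic-extendˡ {r} {p} {a} {b} {c} r∣p a+p+p≤c c+r≤b perᵖ perʳ i a≤i i+r<b with a + p ≤? i
  ... | yes a+p≤i = perʳ i a+p≤i i+r<b
  ... | no  a+p≰i = begin
    f i           ≡⟨ perᵖ′ i a≤i (≤-<-trans (m≤m+n (i + p) r) i+p+r<b) ⟩
    f (i + p)     ≡⟨ perʳ (i + p) (+-monoˡ-≤ p a≤i) i+p+r<b ⟩
    f (i + p + r) ≡⟨ cong f (m+n+o≡m+o+n i p r) ⟩
    f (i + r + p) ≡⟨ perᵖ′ (i + r) (≤-trans a≤i (m≤m+n i r)) (subst (_< b) (m+n+o≡m+o+n i p r) i+p+r<b) ⟨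
    f (i + r)     ∎
    where
    open ≡-Reasoning
    perᵖ′ : Periodic p a b
    perᵖ′ = Periodic-∪ a+p+p≤c perᵖ (Periodic-∣ r∣p perʳ)
    i+p+r<b : i + p + r < b
    i+p+r<b = <-≤-trans (+-monoˡ-< r (<-≤-trans (+-monoˡ-< p (≰⇒> a+p≰i)) a+p+p≤c)) c+r≤b

module LastSquares {B : Set} (f : ℕ → B) where
  open Periodicity f

  -- k is 0-based, and an occurrence of the same square at k + r is exactly period r on [k, k + 2n + r).
  LastSquare : ℕ → ℕ → Set
  LastSquare k n = Periodic n k (k + n + n) × (∀ r → 0 < r → ¬ Periodic r k (k + n + n + r))

  LastSquares⇒longer<n+n : ∀ {k n m} → LastSquare k n → LastSquare k m → n < m → m < n + n
  LastSquares⇒longer<n+n {k} {n} {m} (_ , aperiodic) (perᵐ , _) n<m with m <? n + n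
  ... | yes m<n+n = m<n+n
  ... | no  m≮n+n = ⊥-elim (aperiodic m (≤-<-trans z≤n n<m) (Periodic-mono ≤-refl room perᵐ))
    where
    room : k + n + n + m ≤ k + m + m
    room = begin
      k + n + n + m   ≡⟨ solve (k ∷ n ∷ m ∷ []) ⟩
      k + m + (n + n) ≤⟨ +-monoʳ-≤ (k + m) (≮⇒≥ m≮n+n) ⟩
      k + m + m       ∎
      where open ≤-Reasoning

  module LongerRoots {p d e : ℕ} (0<d : 0 < d) (0<e : 0 < e) (d≤p : d ≤ p) (e≤p : e ≤ p)
    (sq₁ : Periodic p 0 (p + p)) (sq₂ : Periodic p 1 (1 + p + p))
    (SQ₁ : Periodic (p + d) 0 (p + d + (p + d))) (SQ₂ : Periodic (p + e) 1 (1 + (p + e) + (p + e)))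
    where

    N : ℕ
    N = 1 + p + p

    periodᵖ : Periodic p 0 N
    periodᵖ = Periodic-∪ (m<m+n p (<-≤-trans 0<d d≤p)) sq₁ sq₂

    periodᵈ : Periodic d p (N + d)
    periodᵈ = Periodic-shift periodᵖ (Periodic-mono ≤-refl room SQ₁)
      where
      room : N + d ≤ p + d + (p + d)
      room = begin-strict
        p + p + d       <⟨ m<m+n (p + p + d) 0<d ⟩
        p + p + d + d   ≡⟨ solve (p ∷ d ∷ []) ⟩
        p + d + (p + d) ∎
        where open ≤-Reasoning

    periodᵉ : Periodic e (suc p) (N + e)
    periodᵉ = Periodic-shift (Periodic-mono z≤n ≤-refl periodᵖ) (Periodic-mono ≤-refl room SQ₂)
      where
      room : N + e ≤ 1 + (p + e) + (p + e)
      room = s≤s (begin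
        p + p + e       ≤⟨ m≤m+n (p + p + e) e ⟩
        p + p + e + e   ≡⟨ solve (p ∷ e ∷ []) ⟩
        p + e + (p + e) ∎)
        where open ≤-Reasoning

    d<e⇒period : d < e → ∃[ r ] 0 < r × Periodic r 1 (N + r)
    d<e⇒period d<e = r , 0<r , Periodic-extendˡ r∣p ≤-refl ≤-refl sq₂
                                 (Periodic-mono (n≤1+n p) (+-monoʳ-≤ N r≤e) periodʳ)
      where
      g : ℕ
      g = gcd d e
      0<g : 0 < g
      0<g = m>0⇒gcd[m,n]>0 e 0<d
      g≤d : g ≤ d
      g≤d = gcd[m,n]≤m e 0<d
      g∣d : g ∣ d
      g∣d = gcd[m,n]∣m d e
      N+d≤N+e : N + d ≤ N + e
      N+d≤N+e = +-monoʳ-≤ N (<⇒≤ d<e)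
      periodᵍ : Periodic g (suc p) (N + d)
      periodᵍ = fineWilf d e (s≤s (subst (_≤ p + p + d) (m+n+o≡m+o+n p e d) (+-monoˡ-≤ d (+-monoʳ-≤ p e≤p))))
        (Periodic-mono (n≤1+n p) ≤-refl periodᵈ) (Periodic-mono ≤-refl N+d≤N+e periodᵉ)
      periodᵍ′ : Periodic g (suc p) (N + e)
      periodᵍ′ = Periodic-extend 0<e (s≤s (+-mono-≤ (+-monoʳ-≤ p e≤p) g≤d)) periodᵉ periodᵍ
      p+d<N+d : p + d < N + d
      p+d<N+d = s≤s (+-monoˡ-≤ d (m≤m+n p p))
      periodᵍ″ : Periodic g p (N + e)
      periodᵍ″ = Periodic-stepˡ-∣ 0<g g∣d g≤d (<-≤-trans p+d<N+d N+d≤N+e) (periodᵈ p ≤-refl p+d<N+d) periodᵍ′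
      -- Starting at p rather than p + 1 keeps [p, p + g + P) inside [0, 2P), where period P is known.
      periodᴾ : Periodic (p + d) p (N + e)
      periodᴾ = Periodic-extend 0<g ≤-refl periodᵍ″ (Periodic-mono z≤n (+-monoˡ-≤ (p + d) (+-monoʳ-≤ p g≤d)) SQ₁)
      r : ℕ
      r = gcd g (p + d)
      0<r : 0 < r
      0<r = m>0⇒gcd[m,n]>0 (p + d) 0<g
      r∣p : r ∣ p
      r∣p = gcd[m,n+o]∣n p g∣d
      r≤e : r ≤ e
      r≤e = ≤-trans (gcd[m,n]≤m (p + d) 0<g) (≤-trans g≤d (<⇒≤ d<e))
      periodʳ : Periodic r p (N + e)
      periodʳ = fineWilf g (p + d) room periodᵍ″ periodᴾ
        where
        room : p + g + (p + d) ≤ N + e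
        room = begin
          p + g + (p + d) ≡⟨ m+n+[m+o]≡m+m+[o+n] p g d ⟩
          p + p + (d + g) ≤⟨ +-monoʳ-≤ (p + p) (m<n∧d∣m∧d∣n⇒m+d≤n d<e g∣d (gcd[m,n]∣n d e)) ⟩
          p + p + e       ≤⟨ n≤1+n _ ⟩
          N + e           ∎
          where open ≤-Reasoning

    e<d⇒period : e < d → ∃[ r ] 0 < r × Periodic r 1 (N + r)
    e<d⇒period e<d = r , 0<r , Periodic-extendˡ r∣p ≤-refl ≤-refl sq₂
                                 (Periodic-mono ≤-refl (+-monoʳ-≤ N r≤d) periodʳ)
      where
      g : ℕ
      g = gcd d e
      0<g : 0 < g
      0<g = m>0⇒gcd[m,n]>0 e 0<d
      g≤e : g ≤ e
      g≤e = gcd[m,n]≤n d e {{>-nonZero 0<e}}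
      g∣e : g ∣ e
      g∣e = gcd[m,n]∣n d e
      periodᵍ : Periodic g (suc p) (N + e)
      periodᵍ = fineWilf d e (s≤s (+-monoˡ-≤ e (+-monoʳ-≤ p d≤p)))
        (Periodic-mono (n≤1+n p) (+-monoʳ-≤ N (<⇒≤ e<d)) periodᵈ) periodᵉ
      periodᵍ′ : Periodic g (suc p) (N + d)
      periodᵍ′ = Periodic-extend 0<d (s≤s (+-mono-≤ (+-monoʳ-≤ p d≤p) g≤e))
        (Periodic-mono (n≤1+n p) ≤-refl periodᵈ) periodᵍ
      periodᴽ : Periodic (p + e) (suc p) (N + d)
      periodᴽ = Periodic-extend 0<g ≤-refl periodᵍ′
        (Periodic-mono (s≤s z≤n) (s≤s (+-monoˡ-≤ (p + e) (+-monoʳ-≤ p g≤e))) SQ₂)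
      r : ℕ
      r = gcd g (p + e)
      0<r : 0 < r
      0<r = m>0⇒gcd[m,n]>0 (p + e) 0<g
      r∣p : r ∣ p
      r∣p = gcd[m,n+o]∣n p g∣e
      r≤d : r ≤ d
      r≤d = ≤-trans (gcd[m,n]≤m (p + e) 0<g) (≤-trans g≤e (<⇒≤ e<d))
      periodʳ : Periodic r (suc p) (N + d)
      periodʳ = fineWilf g (p + e) room periodᵍ′ periodᴽ
        where
        room : suc p + g + (p + e) ≤ N + d
        room = s≤s (begin
          p + g + (p + e) ≡⟨ m+n+[m+o]≡m+m+[o+n] p g e ⟩
          p + p + (e + g) ≤⟨ +-monoʳ-≤ (p + p) (m<n∧d∣m∧d∣n⇒m+d≤n e<d g∣e (gcd[m,n]∣m d e)) ⟩
          p + p + d       ∎)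
          where open ≤-Reasoning

    distinctLongerRoots⇒period : d ≢ e → ∃[ r ] 0 < r × Periodic r 1 (N + r)
    distinctLongerRoots⇒period d≢e with <-cmp d e
    ... | tri< d<e _ _ = d<e⇒period d<e
    ... | tri≈ _ d≡e _ = ⊥-elim (d≢e d≡e)
    ... | tri> _ _ e<d = e<d⇒period e<d

  longerRoots-equal : ∀ {p p′ P Q} → LastSquare 0 p → LastSquare 0 P → LastSquare 1 p′ → LastSquare 1 Q
    → p < P → p′ < Q → p ≡ p′ → P ≡ Q
  longerRoots-equal {p} sq₁ SQ₁ sq₂ SQ₂ p<P p<Q refl
    with m<n<m+m⇒∃[d]n≡m+d p<P (LastSquares⇒longer<n+n sq₁ SQ₁ p<P)
       | m<n<m+m⇒∃[d]n≡m+d p<Q (LastSquares⇒longer<n+n sq₂ SQ₂ p<Q)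
  ... | d , refl , 0<d , d≤p | e , refl , 0<e , e≤p with d ≟ e
  ... | yes d≡e = cong (p +_) d≡e
  ... | no  d≢e with LongerRoots.distinctLongerRoots⇒period 0<d 0<e d≤p e≤p
                       (proj₁ sq₁) (proj₁ sq₂) (proj₁ SQ₁) (proj₁ SQ₂) d≢e
  ... | r , 0<r , periodʳ = ⊥-elim (proj₂ sq₂ r 0<r periodʳ)

nth : ∀ {A : Set} → List A → ℕ → Maybe A
nth []       _       = nothing
nth (x ∷ xs) zero    = just x
nth (x ∷ xs) (suc i) = nth xs i

module _ {A : Set} where

  nth-drop : ∀ k (xs : List A) i → nth (drop k xs) i ≡ nth xs (k + i)
  nth-drop zero    xs       i = refl
  nth-drop (suc k) []       i = refl
  nth-drop (suc k) (x ∷ xs) i = nth-drop k xs i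

  nth-++ˡ : ∀ (xs ys : List A) {i} → i < length xs → nth (xs ++ ys) i ≡ nth xs i
  nth-++ˡ (x ∷ xs) ys {zero}  _           = refl
  nth-++ˡ (x ∷ xs) ys {suc i} (s≤s i<xs) = nth-++ˡ xs ys i<xs

  nth-++ʳ : ∀ (xs ys : List A) i → nth (xs ++ ys) (length xs + i) ≡ nth ys i
  nth-++ʳ []       ys i = refl
  nth-++ʳ (x ∷ xs) ys i = nth-++ʳ xs ys i

  nth-square : ∀ (u s : List A) {i} → i < length u → nth (u ++ u ++ s) i ≡ nth (u ++ u ++ s) (length u + i)
  nth-square u s {i} i<u = begin
    nth (u ++ u ++ s) i              ≡⟨ nth-++ˡ u (u ++ s) i<u ⟩
    nth u i                          ≡⟨ nth-++ˡ u s i<u ⟨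
    nth (u ++ s) i                   ≡⟨ nth-++ʳ u (u ++ s) i ⟨
    nth (u ++ u ++ s) (length u + i) ∎
    where open ≡-Reasoning

  nth⇒prefix : ∀ (xs ys : List A) → (∀ i → i < length xs → nth ys i ≡ nth xs i) → ∃[ s ] ys ≡ xs ++ s
  nth⇒prefix []       ys       _     = ys , refl
  nth⇒prefix (x ∷ xs) []       agree with agree 0 z<s
  ... | ()
  nth⇒prefix (x ∷ xs) (y ∷ ys) agree with nth⇒prefix xs ys (λ i i<xs → agree (suc i) (s≤s i<xs))
  ... | s , ys≡xs++s = s , cong₂ _∷_ (just-injective (agree 0 z<s)) ys≡xs++s

module Squares {A : Set} (w : List A) where
  open Periodicity (nth w)
  open LastSquares (nth w)

  square⇒Periodic : ∀ {k u s} → drop k w ≡ u ++ u ++ s → Periodic (length u) k (k + length u + length u)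
  square⇒Periodic {k} {u} {s} eq i k≤i i+u<k+u+u with m≤n⇒∃[o]m+o≡n k≤i
  ... | j , refl = begin
    nth w (k + j)                    ≡⟨ nth-drop k w j ⟨
    nth (drop k w) j                 ≡⟨ cong (λ v → nth v j) eq ⟩
    nth (u ++ u ++ s) j              ≡⟨ nth-square u s j<u ⟩
    nth (u ++ u ++ s) (length u + j) ≡⟨ cong (λ v → nth v (length u + j)) eq ⟨
    nth (drop k w) (length u + j)    ≡⟨ nth-drop k w (length u + j) ⟩
    nth w (k + (length u + j))       ≡⟨ cong (nth w) (m+n+o≡m+[o+n] k j (length u)) ⟨
    nth w (k + j + length u)         ∎
    where
    open ≡-Reasoning
    j<u : j < length u
    j<u = +-cancelˡ-< (k + length u) j (length u)
            (subst (_< k + length u + length u) (m+n+o≡m+o+n k j (length u)) i+u<k+u+u)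

  Periodic⇒square : ∀ {k r u s} → drop k w ≡ u ++ u ++ s → Periodic r k (k + length u + length u + r)
    → ∃[ s′ ] drop (k + r) w ≡ u ++ u ++ s′
  Periodic⇒square {k} {r} {u} {s} eq periodʳ with nth⇒prefix (u ++ u) (drop (k + r) w) agree
    where
    agree : ∀ i → i < length (u ++ u) → nth (drop (k + r) w) i ≡ nth (u ++ u) i
    agree i i<uu = begin
      nth (drop (k + r) w) i ≡⟨ nth-drop (k + r) w i ⟩
      nth w (k + r + i)      ≡⟨ cong (nth w) (m+n+o≡m+o+n k r i) ⟩
      nth w (k + i + r)      ≡⟨ periodʳ (k + i) (m≤m+n k i) (+-monoˡ-< r k+i<k+u+u) ⟨
      nth w (k + i)          ≡⟨ nth-drop k w i ⟨
      nth (drop k w) i       ≡⟨ cong (λ v → nth v i) (trans eq (sym (++-assoc u u s))) ⟩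
      nth ((u ++ u) ++ s) i  ≡⟨ nth-++ˡ (u ++ u) s i<uu ⟩
      nth (u ++ u) i         ∎
      where
      open ≡-Reasoning
      k+i<k+u+u : k + i < k + length u + length u
      k+i<k+u+u = subst (k + i <_) (sym (+-assoc k (length u) (length u)))
                    (+-monoʳ-< k (subst (i <_) (length-++ u) i<uu))
  ... | s′ , eq′ = s′ , trans eq′ (++-assoc u u s′)

  lastOccAt⇒LastSquare : ∀ {k u} → LastOccAt w (suc k) u → LastSquare k (length u)
  lastOccAt⇒LastSquare {k} {u} (_ , occ _ _ s eq , later) = square⇒Periodic {u = u} eq , notLater
    where
    notLater : ∀ r → 0 < r → ¬ Periodic r k (k + length u + length u + r)
    notLater r 0<r periodʳ with Periodic⇒square {u = u} eq periodʳ
    ... | s′ , eq′ = later (suc (k + r)) (s≤s (m<m+n k 0<r)) (occ (k + r) u s′ eq′)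

lemma7 : {A : Set} (w sq₁ SQ₁ sq₂ SQ₂ : List A)
    → TwoLastAt w 1 sq₁ SQ₁
    → TwoLastAt w 2 sq₂ SQ₂
    → length sq₁ < length SQ₁
    → length sq₂ < length SQ₂
    → length sq₁ ≡ length sq₂
    → length SQ₁ ≡ length SQ₂
lemma7 w sq₁ SQ₁ sq₂ SQ₂ (_ , sq₁-last , SQ₁-last , _) (_ , sq₂-last , SQ₂-last , _) =
  longerRoots-equal (lastOccAt⇒LastSquare sq₁-last) (lastOccAt⇒LastSquare SQ₁-last)
                    (lastOccAt⇒LastSquare sq₂-last) (lastOccAt⇒LastSquare SQ₂-last)
  where
  open LastSquares (nth w)
  open Squares w
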